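{- Let $w$ be an $n$-web and let $x_{i_1}x_{i_2}\cdots x_{i_m}$ be a word such that $w$ is isotopic to the stacked diagram $d_{i_1}d_{i_2}\cdots d_{i_m}$ (with $d_{i_1}$ on top). Then $\varphi(x_{i_1}\cdots x_{i_m})$ equals the right sequence couple of the permutation $p(w)$.
   Context: An $n$-diagram is a continuous map from $n+1$ copies of $[0,1]$ to $\mathbb{R}\times[0,1]$, each strand projecting vertically bijectively onto $[0,1]$, endpoints at $(k,0),(l,1)$ with $k,l\in\{1,\dots,n+1\}$, injective except at finitely many interior transverse double points, up to isotopy; composition $dd'$ places $d$ on top of $d'$. The elementary $d_i$ has vertical strands except two strands $(i,0)\to(i+1,1)$ and $(i+1,0)\to(i,1)$ crossing once. An $n$-web is an $n$-diagram where any two strands cross at most once and no three strands cross pairwise. $p(w)\in S_{n+1}$ sends the $x$-coordinate of the lower endpoint of each strand to that of its upper endpoint. The right sequence couple of $s\in S_{n+1}$ is $((a_t),(b_t))$ with $(a_t)$ the increasing list of all $i$ with $s(i)>i$ and $b_t=s(a_t)$. $\mathsf{L}_n$ acts on $\mathbb{N}^{n+1}$ by letting $x_i$ replace the $(i+1)$-st component by the $i$-th one: $(c_1,\dots,c_{n+1})\mapsto(c_1,\dots,c_i,c_i,c_{i+2},\dots,c_{n+1})$, a word acting by composition with its rightmost letter applied first. For $x\in\mathsf{L}_n$ let $y=x\cdot(1,2,\dots,n+1)$; let $(a_t)$ be the increasing list of the distinct values occurring in $y$, let $b_t$ be the position of the rightmost occurrence of $a_t$ in $y$, and discard all indices $t$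 with $b_t=a_t$; the resulting couple of sequences is $\varphi(x)$. -}

module Defs where

open import Data.Nat using (ℕ; zero; suc; _+_; _≤_; _<_; _≡ᵇ_; _<?_)
open import Data.Bool using (Bool; true; false; if_then_else_; _∧_; _∨_)
open import Data.List using (List; []; _∷_; map; filter; unzip; applyUpTo)
open import Data.Maybe using (Maybe; just; nothing)
open import Data.Product using (_×_; _,_)
open import Relation.Nullary using (¬_)

-- Words in L_n are lists of letter indices i (standing for x_i, 1 ≤ i ≤ n),
-- written left to right: [i₁, …, i_m] is x_{i₁} ⋯ x_{i_m}.
-- The stacked diagram d_{i₁} ⋯ d_{i_m} has d_{i₁} on top.

positions : ℕ → List ℕ
positions n = applyUpTo suc (suc n)

swapAt : ℕ → ℕ → ℕ
swapAt i k = if k ≡ᵇ i then suc i else (if k ≡ᵇ suc i then i else k)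

-- p of the stacked diagram d_{i₁} ⋯ d_{i_m}: the strand with lower endpoint k
-- ends at x-coordinate  s_{i₁}(s_{i₂}(⋯ s_{i_m}(k))).
perm : List ℕ → ℕ → ℕ
perm []      k = k
perm (i ∷ w) k = swapAt i (perm w k)

-- Number of crossings between strands a and b (labelled by the x-coordinate of
-- their lower endpoints) in the stacked diagram of a word.  The layer d_i at the
-- head of (i ∷ w) sits above the diagram of w; the two strands cross there iff
-- their positions after w are {i, i+1}.
crossings : ℕ → ℕ → List ℕ → ℕ
crossings a b []      = 0
crossings a b (i ∷ w) =
  (if ((perm w a ≡ᵇ i) ∧ (perm w b ≡ᵇ suc i)) ∨ ((perm w a ≡ᵇ suc i) ∧ (perm w b ≡ᵇ i))
   then 1 else 0) + crossings a b w

IsWeb : ℕ → List ℕ → Set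
IsWeb n w =
  (∀ a b → 1 ≤ a → a < b → b ≤ suc n → crossings a b w ≤ 1)
  × (∀ a b c → 1 ≤ a → a < b → b < c → c ≤ suc n →
       ¬ ((1 ≤ crossings a b w) × (1 ≤ crossings b c w) × (1 ≤ crossings a c w)))

-- Action of x_i on ℕ^{n+1} (vectors as functions on positions):
-- replace the (i+1)-st component by the i-th one.
actX : ℕ → (ℕ → ℕ) → (ℕ → ℕ)
actX i c j = if j ≡ᵇ suc i then c i else c j

-- y = x · (1, 2, …, n+1), rightmost letter applied first.
actWord : List ℕ → (ℕ → ℕ) → (ℕ → ℕ)
actWord []      c = c
actWord (i ∷ w) c = actX i (actWord w c)

rightmost : (ℕ → ℕ) → ℕ → ℕ → Maybe ℕ
rightmost y v zero    = nothing
rightmost y v (suc k) = if y (suc k) ≡ᵇ v then just (suc k) else rightmost y v k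

-- Values a (in increasing order) occurring in y, paired with their rightmost
-- position b, discarding pairs with b = a.  (All values of y lie in 1..n+1.)
phiPairs : ℕ → (ℕ → ℕ) → List ℕ → List (ℕ × ℕ)
phiPairs n y []      = []
phiPairs n y (a ∷ as) with rightmost y a (suc n)
... | nothing = phiPairs n y as
... | just b  = if b ≡ᵇ a then phiPairs n y as else (a , b) ∷ phiPairs n y as

φ : ℕ → List ℕ → List ℕ × List ℕ
φ n x = unzip (phiPairs n (actWord x (λ j → j)) (positions n))

rightSeqCouple : ℕ → (ℕ → ℕ) → List ℕ × List ℕ
rightSeqCouple n s = unzip (map (λ i → i , s i) (filter (λ i → i <? s i) (positions n)))

-- Label strands by their lower endpoints and let σ = p(w).  By induction on the word,
-- using that two strands cross at most once, y = x · (1, …, n+1) satisfies: y_j is the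
-- least strand a with j ≤ σ a.  Hence every position j with y_j = a lies in [a, σ a], so
-- a value a with σ a ≤ a can only occur at position a and is discarded by φ.  If a < σ a
-- then y_{σ a} = a: otherwise the least strand b reaching σ a has b < a, and since σ moves
-- a to the right, by pigeonhole some strand c > a ends at or left of a; then b, a, c
-- cross pairwise, which a web forbids.  So the rightmost occurrence of a is at σ a.
module Submission where

open import Defs
open import Data.Nat using (ℕ; _≤_)
open import Data.List using (List)
open import Data.List.Relation.Unary.All using (All)
open import Data.Product using (_×_)
open import Relation.Binary.PropositionalEquality using (_≡_)

open import Data.Bool using (true; false; T)
open import Data.Fin using (Fin; toℕ; fromℕ<)
open import Data.Fin.Properties using (toℕ≤pred[n]; toℕ-fromℕ<; toℕ-injective; injective⇒≤)
open import Data.List using ([]; _∷_; map; filter; unzip)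
open import Data.List.Properties using (filter-accept; filter-reject)
open import Data.List.Relation.Unary.All using ([]; _∷_)
import Data.List.Relation.Unary.All as All
open import Data.List.Relation.Unary.All.Properties using (applyUpTo⁺₁)
open import Data.Maybe using (Maybe; just; nothing)
open import Data.Nat using (zero; suc; _+_; _<_; _∸_; _≡ᵇ_; _≟_; _<?_; _≤?_; z≤n; s≤s; s≤s⁻¹)
open import Data.Nat.Properties
open import Data.Product using (_,_; proj₁; proj₂)
open import Data.Unit using (tt)
open import Function using (_∘_)
open import Relation.Binary using (tri<; tri≈; tri>)
open import Relation.Binary.PropositionalEquality
  using (refl; sym; trans; cong; subst; subst₂; _≢_; ≢-sym)
open import Relation.Nullary using (¬_; contradiction; yes; no)

≡ᵇ-refl : ∀ m → (m ≡ᵇ m) ≡ true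
≡ᵇ-refl zero    = refl
≡ᵇ-refl (suc m) = ≡ᵇ-refl m

≡ᵇ-true⇒≡ : ∀ {m k} → (m ≡ᵇ k) ≡ true → m ≡ k
≡ᵇ-true⇒≡ {m} {k} e = ≡ᵇ⇒≡ m k (subst T (sym e) tt)

≢⇒≡ᵇ-false : ∀ {m k} → m ≢ k → (m ≡ᵇ k) ≡ false
≢⇒≡ᵇ-false {m} {k} m≢k with m ≡ᵇ k in e
... | true  = contradiction (≡ᵇ-true⇒≡ e) m≢k
... | false = refl

≡ᵇ-false⇒≢ : ∀ {m k} → (m ≡ᵇ k) ≡ false → m ≢ k
≡ᵇ-false⇒≢ {m} m≡ᵇk refl with () ← trans (sym (≡ᵇ-refl m)) m≡ᵇk

data SwapAt (i : ℕ) : ℕ → ℕ → Set where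
  lower : SwapAt i i (suc i)
  upper : SwapAt i (suc i) i
  fixed : ∀ {k} → k ≢ i → k ≢ suc i → SwapAt i k k

swapAt-view : ∀ i k → SwapAt i k (swapAt i k)
swapAt-view i k with k ≡ᵇ i in k≡ᵇi
... | true with refl ← ≡ᵇ-true⇒≡ {k} {i} k≡ᵇi = lower
... | false with k ≡ᵇ suc i in k≡ᵇ1+i
...   | true with refl ← ≡ᵇ-true⇒≡ {k} {suc i} k≡ᵇ1+i = upper
...   | false = fixed (≡ᵇ-false⇒≢ k≡ᵇi) (≡ᵇ-false⇒≢ k≡ᵇ1+i)

swapAt-lower : ∀ i → swapAt i i ≡ suc i
swapAt-lower i with swapAt i i | swapAt-view i i
... | _ | lower         = refl
... | _ | fixed i≢i _   = contradiction refl i≢i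

swapAt-upper : ∀ i → swapAt i (suc i) ≡ i
swapAt-upper i with swapAt i (suc i) | swapAt-view i (suc i)
... | _ | upper          = refl
... | _ | fixed _ 1+i≢1+i = contradiction refl 1+i≢1+i

swapAt-fixed : ∀ {i k} → k ≢ i → k ≢ suc i → swapAt i k ≡ k
swapAt-fixed {i} {k} k≢i k≢1+i with swapAt i k | swapAt-view i k
... | _ | lower     = contradiction refl k≢i
... | _ | upper     = contradiction refl k≢1+i
... | _ | fixed _ _ = refl

swapAt-involutive : ∀ i k → swapAt i (swapAt i k) ≡ k
swapAt-involutive i k with swapAt i k | swapAt-view i k
... | _ | lower             = swapAt-upper i
... | _ | upper             = swapAt-lower i
... | _ | fixed k≢i k≢1+i   = swapAt-fixed k≢i k≢1+i

swapAt-<-mono : ∀ {i u v} → u < v → ¬ (u ≡ i × v ≡ suc i) → swapAt i u < swapAt i v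
swapAt-<-mono {i} {u} {v} u<v ¬adjacent
  with swapAt i u | swapAt-view i u | swapAt i v | swapAt-view i v
... | _ | lower | _ | lower = contradiction u<v (<-irrefl refl)
... | _ | lower | _ | upper = contradiction (refl , refl) ¬adjacent
... | _ | lower | _ | fixed _ v≢1+i = ≤∧≢⇒< u<v (≢-sym v≢1+i)
... | _ | upper | _ | lower = contradiction u<v (<-asym (n<1+n i))
... | _ | upper | _ | upper = contradiction u<v (<-irrefl refl)
... | _ | upper | _ | fixed _ _ = <-trans (n<1+n i) u<v
... | _ | fixed _ _ | _ | lower = m<n⇒m<1+n u<v
... | _ | fixed u≢i _ | _ | upper = ≤∧≢⇒< (s≤s⁻¹ u<v) u≢i
... | _ | fixed _ _ | _ | fixed _ _ = u<v

swapAt-≥ : ∀ {i j v} → j ≢ suc i → j ≤ v → j ≤ swapAt i v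
swapAt-≥ {i} {j} {v} j≢1+i j≤v with swapAt i v | swapAt-view i v
... | _ | lower     = m≤n⇒m≤1+n j≤v
... | _ | upper     = s≤s⁻¹ (≤∧≢⇒< j≤v j≢1+i)
... | _ | fixed _ _ = j≤v

swapAt-< : ∀ {i j v} → j ≢ suc i → v < j → swapAt i v < j
swapAt-< {i} {j} {v} j≢1+i v<j = ≰⇒> λ j≤sv →
  <⇒≱ v<j (subst (j ≤_) (swapAt-involutive i v) (swapAt-≥ j≢1+i j≤sv))

swapAt-> : ∀ {i v} → i ≤ v → v ≢ suc i → i < swapAt i v
swapAt-> {i} {v} i≤v v≢1+i with swapAt i v | swapAt-view i v
... | _ | lower     = ≤-refl
... | _ | upper     = contradiction refl v≢1+i
... | _ | fixed v≢i _ = ≤∧≢⇒< i≤v (≢-sym v≢i)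

perm⁻¹ : List ℕ → ℕ → ℕ
perm⁻¹ []      k = k
perm⁻¹ (i ∷ w) k = perm⁻¹ w (swapAt i k)

perm-perm⁻¹ : ∀ w k → perm w (perm⁻¹ w k) ≡ k
perm-perm⁻¹ []      k = refl
perm-perm⁻¹ (i ∷ w) k =
  trans (cong (swapAt i) (perm-perm⁻¹ w (swapAt i k))) (swapAt-involutive i k)

perm⁻¹-perm : ∀ w k → perm⁻¹ w (perm w k) ≡ k
perm⁻¹-perm []      k = refl
perm⁻¹-perm (i ∷ w) k =
  trans (cong (perm⁻¹ w) (swapAt-involutive i (perm w k))) (perm⁻¹-perm w k)

perm-injective : ∀ w {a b} → perm w a ≡ perm w b → a ≡ b
perm-injective w {a} {b} σa≡σb =
  trans (sym (perm⁻¹-perm w a)) (trans (cong (perm⁻¹ w) σa≡σb) (perm⁻¹-perm w b))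

crossings-≤-cons : ∀ a b i w → crossings a b w ≤ crossings a b (i ∷ w)
crossings-≤-cons a b i w = m≤n+m (crossings a b w) _

crossings-cons-lower : ∀ {a b i} w → perm w a ≡ i → perm w b ≡ suc i →
                       crossings a b (i ∷ w) ≡ suc (crossings a b w)
crossings-cons-lower {i = i} w σa≡i σb≡1+i rewrite σa≡i | σb≡1+i | ≡ᵇ-refl i = refl

crossings-cons-upper : ∀ {a b i} w → perm w a ≡ suc i → perm w b ≡ i →
                       crossings a b (i ∷ w) ≡ suc (crossings a b w)
crossings-cons-upper {i = i} w σa≡1+i σb≡i
  rewrite σa≡1+i | σb≡i | ≢⇒≡ᵇ-false (1+n≢n {i}) | ≡ᵇ-refl i = refl

uncrossed⇒ordered : ∀ {a b} w → a < b → crossings a b w ≡ 0 → perm w a < perm w b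
uncrossed⇒ordered []      a<b _     = a<b
uncrossed⇒ordered {a} {b} (i ∷ w) a<b uncrossed =
  swapAt-<-mono (uncrossed⇒ordered w a<b (m+n≡0⇒n≡0 _ uncrossed)) ¬adjacent
  where
    ¬adjacent : ¬ (perm w a ≡ i × perm w b ≡ suc i)
    ¬adjacent (σa≡i , σb≡1+i) = 1+n≢0 (trans (sym (crossings-cons-lower w σa≡i σb≡1+i)) uncrossed)

inverted⇒crossed : ∀ {a b} w → a < b → perm w b < perm w a → 1 ≤ crossings a b w
inverted⇒crossed w a<b σb<σa =
  n≢0⇒n>0 λ uncrossed → <-asym (uncrossed⇒ordered w a<b uncrossed) σb<σa

ℕ-pigeonhole : ∀ m (f : ℕ → ℕ) → (∀ {t} → t ≤ m → f t < m) →
               ¬ (∀ {s t} → s ≤ m → t ≤ m → f s ≡ f t → s ≡ t)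
ℕ-pigeonhole m f f<m f-injective = 1+n≰n (injective⇒≤ F-injective)
  where
    F : Fin (suc m) → Fin m
    F s = fromℕ< (f<m (toℕ≤pred[n] s))

    F-injective : ∀ {s t} → F s ≡ F t → s ≡ t
    F-injective {s} {t} Fs≡Ft = toℕ-injective (f-injective (toℕ≤pred[n] s) (toℕ≤pred[n] t)
      (trans (sym (toℕ-fromℕ< _)) (trans (cong toℕ Fs≡Ft) (toℕ-fromℕ< _))))

¬closed-above : ∀ {N k a} (σ : ℕ → ℕ) → (∀ {c d} → σ c ≡ σ d → c ≡ d) →
                (∀ {c} → k < c → c ≤ N → σ c ≤ N) → a ≤ k → k < σ a → σ a ≤ N →
                ¬ (∀ {c} → k < c → c ≤ N → k < σ c)
¬closed-above {N} {k} {a} σ σ-injective σ≤N a≤k k<σa σa≤N closed =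
  ℕ-pigeonhole (N ∸ k) f f<N∸k f-injective
  where
    k≤N : k ≤ N
    k≤N = ≤-trans (<⇒≤ k<σa) σa≤N

    -- g enumerates a, k+1, …, N; then σ ∘ g would inject N ∸ k + 1 points into (k, N].
    g : ℕ → ℕ
    g zero    = a
    g (suc t) = suc t + k

    g-injective : ∀ {s t} → g s ≡ g t → s ≡ t
    g-injective {zero}  {zero}  _   = refl
    g-injective {zero}  {suc t} a≡ = contradiction (subst (_≤ k) a≡ a≤k) (<⇒≱ (s≤s (m≤n+m k t)))
    g-injective {suc s} {zero}  ≡a = sym (g-injective {zero} {suc s} (sym ≡a))
    g-injective {suc s} {suc t} eq = cong suc (+-cancelʳ-≡ k s t (suc-injective eq))

    σg-above : ∀ {t} → t ≤ N ∸ k → k < σ (g t) × σ (g t) ≤ N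
    σg-above {zero}  _      = k<σa , σa≤N
    σg-above {suc t} t<N∸k = closed k<c c≤N , σ≤N k<c c≤N
      where
        k<c = s≤s (m≤n+m k t)
        c≤N = m≤o∸n⇒m+n≤o (suc t) k≤N t<N∸k

    f : ℕ → ℕ
    f t = σ (g t) ∸ suc k

    f<N∸k : ∀ {t} → t ≤ N ∸ k → f t < N ∸ k
    f<N∸k t≤ = ∸-monoˡ-< (s≤s (proj₂ (σg-above t≤))) (proj₁ (σg-above t≤))

    f-injective : ∀ {s t} → s ≤ N ∸ k → t ≤ N ∸ k → f s ≡ f t → s ≡ t
    f-injective s≤ t≤ fs≡ft =
      g-injective (σ-injective (∸-cancelʳ-≡ (proj₁ (σg-above s≤)) (proj₁ (σg-above t≤)) fs≡ft))

rightmost-sound : ∀ {f v m} K → rightmost f v K ≡ just m → f m ≡ v × 1 ≤ m × m ≤ K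
rightmost-sound zero ()
rightmost-sound {f} {v} (suc K) found with f (suc K) ≡ᵇ v in e
... | true with refl ← found = ≡ᵇ-true⇒≡ {f (suc K)} {v} e , s≤s z≤n , ≤-refl
... | false with rightmost-sound K found
...   | fm≡v , 1≤m , m≤K = fm≡v , 1≤m , m≤n⇒m≤1+n m≤K

rightmost-last : ∀ {f v m} K → 1 ≤ m → m ≤ K → f m ≡ v → (∀ {j} → m < j → j ≤ K → f j ≢ v) →
                 rightmost f v K ≡ just m
rightmost-last zero 1≤m m≤0 _ _ = contradiction (≤-trans 1≤m m≤0) λ ()
rightmost-last {f} {v} {m} (suc K) 1≤m m≤1+K fm≡v later with f (suc K) ≡ᵇ v in e | m ≟ suc K
... | true  | yes refl = refl
... | true  | no m≢1+K =
  contradiction (≡ᵇ-true⇒≡ {f (suc K)} {v} e) (later (≤∧≢⇒< m≤1+K m≢1+K) ≤-refl)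
... | false | yes refl = contradiction fm≡v (≡ᵇ-false⇒≢ e)
... | false | no m≢1+K =
  rightmost-last K 1≤m (s≤s⁻¹ (≤∧≢⇒< m≤1+K m≢1+K)) fm≡v (λ m<j j≤K → later m<j (m≤n⇒m≤1+n j≤K))

data RightmostOf (s : ℕ → ℕ) (a : ℕ) : Maybe ℕ → Set where
  moved  : a < s a → RightmostOf s a (just (s a))
  absent : ¬ a < s a → RightmostOf s a nothing
  stays  : ¬ a < s a → RightmostOf s a (just a)

rightPairs : (ℕ → ℕ) → List ℕ → List (ℕ × ℕ)
rightPairs s as = map (λ i → i , s i) (filter (λ i → i <? s i) as)

rightPairs-accept : ∀ s {a} as → a < s a → rightPairs s (a ∷ as) ≡ (a , s a) ∷ rightPairs s as
rightPairs-accept s as a<sa = cong (map _) (filter-accept (λ i → i <? s i) a<sa)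

rightPairs-reject : ∀ s {a} as → ¬ a < s a → rightPairs s (a ∷ as) ≡ rightPairs s as
rightPairs-reject s as ¬a<sa = cong (map _) (filter-reject (λ i → i <? s i) ¬a<sa)

phiPairs-rightmostOf : ∀ n f s as → All (λ a → RightmostOf s a (rightmost f a (suc n))) as →
                       phiPairs n f as ≡ rightPairs s as
phiPairs-rightmostOf n f s []       []       = refl
phiPairs-rightmostOf n f s (a ∷ as) (r ∷ rs) with rightmost f a (suc n) | r
... | just .(s a) | moved a<sa rewrite ≢⇒≡ᵇ-false (>⇒≢ a<sa) =
  trans (cong ((a , s a) ∷_) (phiPairs-rightmostOf n f s as rs)) (sym (rightPairs-accept s as a<sa))
... | nothing | absent ¬a<sa =
  trans (phiPairs-rightmostOf n f s as rs) (sym (rightPairs-reject s as ¬a<sa))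
... | just .a | stays ¬a<sa rewrite ≡ᵇ-refl a =
  trans (phiPairs-rightmostOf n f s as rs) (sym (rightPairs-reject s as ¬a<sa))

y : List ℕ → ℕ → ℕ
y w = actWord w (λ j → j)

y-cons-away : ∀ i w {j} → j ≢ suc i → y (i ∷ w) j ≡ y w j
y-cons-away i w j≢1+i rewrite ≢⇒≡ᵇ-false j≢1+i = refl

y-cons-at : ∀ i w → y (i ∷ w) (suc i) ≡ y w i
y-cons-at i w rewrite ≡ᵇ-refl i = refl

record LeastReaching (σ : ℕ → ℕ) (j a : ℕ) : Set where
  field
    positive : 1 ≤ a
    below    : a ≤ j
    reaches  : j ≤ σ a
    least    : ∀ {a′} → a′ < a → σ a′ < j

open LeastReaching

leastReaching-swapAt-away : ∀ {σ i j a} → j ≢ suc i → LeastReaching σ j a →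
                            LeastReaching (swapAt i ∘ σ) j a
leastReaching-swapAt-away j≢1+i L = record
  { positive = positive L
  ; below    = below L
  ; reaches  = swapAt-≥ j≢1+i (reaches L)
  ; least    = swapAt-< j≢1+i ∘ least L
  }

leastReaching-swapAt-at : ∀ {σ i a} → σ a ≢ suc i → LeastReaching σ i a →
                          LeastReaching (swapAt i ∘ σ) (suc i) a
leastReaching-swapAt-at {i = i} σa≢1+i L = record
  { positive = positive L
  ; below    = m≤n⇒m≤1+n (below L)
  ; reaches  = swapAt-> (reaches L) σa≢1+i
  ; least    = m<n⇒m<1+n ∘ swapAt-< (≢-sym 1+n≢n) ∘ least L
  }

module _ (n : ℕ) where

  InRange : ℕ → Set
  InRange k = 1 ≤ k × k ≤ suc n

  Letter : ℕ → Set
  Letter i = 1 ≤ i × i ≤ n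

  letter-inRange : ∀ {i} → Letter i → InRange i
  letter-inRange (1≤i , i≤n) = 1≤i , m≤n⇒m≤1+n i≤n

  swapAt-inRange : ∀ {i k} → Letter i → InRange k → InRange (swapAt i k)
  swapAt-inRange {i} {k} (1≤i , i≤n) k∈ with swapAt i k | swapAt-view i k
  ... | _ | lower     = s≤s z≤n , s≤s i≤n
  ... | _ | upper     = letter-inRange (1≤i , i≤n)
  ... | _ | fixed _ _ = k∈

  perm-inRange : ∀ {w k} → All Letter w → InRange k → InRange (perm w k)
  perm-inRange []          k∈ = k∈
  perm-inRange (i∈ ∷ w∈) k∈ = swapAt-inRange i∈ (perm-inRange w∈ k∈)

  perm⁻¹-inRange : ∀ {w k} → All Letter w → InRange k → InRange (perm⁻¹ w k)
  perm⁻¹-inRange []          k∈ = k∈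
  perm⁻¹-inRange (i∈ ∷ w∈) k∈ = perm⁻¹-inRange w∈ (swapAt-inRange i∈ k∈)

  CrossAtMostOnce : List ℕ → Set
  CrossAtMostOnce w = ∀ a b → 1 ≤ a → a < b → b ≤ suc n → crossings a b w ≤ 1

  crossAtMostOnce-tail : ∀ i w → CrossAtMostOnce (i ∷ w) → CrossAtMostOnce w
  crossAtMostOnce-tail i w once a b 1≤a a<b b≤ =
    ≤-trans (crossings-≤-cons a b i w) (once a b 1≤a a<b b≤)

  adjacent-ordered : ∀ {a b} i w → CrossAtMostOnce (i ∷ w) → InRange a → InRange b →
                     perm w a ≡ i → perm w b ≡ suc i → a < b
  adjacent-ordered {a} {b} i w once a∈ b∈ σa≡i σb≡1+i with <-cmp a b
  ... | tri< a<b _ _ = a<b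
  ... | tri≈ _ refl _ = contradiction (trans (sym σb≡1+i) σa≡i) 1+n≢n
  ... | tri> _ _ b<a = contradiction (once b a (proj₁ b∈) b<a (proj₂ a∈)) crossed-twice
    where
      -- b and a are inverted below the top layer d_i, and cross once more inside it.
      crossed-twice : ¬ crossings b a (i ∷ w) ≤ 1
      crossed-twice ≤1 = contradiction
        (≤-trans (inverted⇒crossed w b<a (subst₂ _<_ (sym σa≡i) (sym σb≡1+i) (n<1+n i)))
                 (s≤s⁻¹ (subst (_≤ 1) (crossings-cons-upper w σb≡1+i σa≡i) ≤1)))
        λ ()

  y-leastReaching : ∀ {w} → All Letter w → CrossAtMostOnce w →
                    ∀ {j} → InRange j → LeastReaching (perm w) j (y w j)
  y-leastReaching [] _ (1≤j , _) = record
    { positive = 1≤j ; below = ≤-refl ; reaches = ≤-refl ; least = λ a′<j → a′<j }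
  y-leastReaching {i ∷ w} (i∈ ∷ w∈) once {j} j∈ with j ≟ suc i
  ... | no j≢1+i rewrite y-cons-away i w j≢1+i =
    leastReaching-swapAt-away j≢1+i (IH j∈)
    where IH = y-leastReaching w∈ (crossAtMostOnce-tail i w once)
  ... | yes refl rewrite y-cons-at i w = leastReaching-swapAt-at σa≢1+i L
    where
      L : LeastReaching (perm w) i (y w i)
      L = y-leastReaching w∈ (crossAtMostOnce-tail i w once) (letter-inRange i∈)

      σa≢1+i : perm w (y w i) ≢ suc i
      σa≢1+i σa≡1+i = <-irrefl σp≡i (least L p<a)
        where
          p = perm⁻¹ w i
          σp≡i = perm-perm⁻¹ w i
          p<a = adjacent-ordered i w once (perm⁻¹-inRange w∈ (letter-inRange i∈))
                  (positive L , ≤-trans (below L) (proj₂ (letter-inRange i∈))) σp≡i σa≡1+i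

  y-image : ∀ {x a} → All Letter x → IsWeb n x → InRange a → a < perm x a → y x (perm x a) ≡ a
  y-image {x} {a} x∈ (once , ¬triangle) a∈ a<σa with <-cmp (y x (perm x a)) a
  ... | tri≈ _ b≡a _ = b≡a
  ... | tri> _ _ a<b = contradiction (least L a<b) (<-irrefl refl)
    where L = y-leastReaching x∈ once (perm-inRange x∈ a∈)
  ... | tri< b<a _ _ = contradiction (λ {c} → closed {c})
                         (¬closed-above (perm x) (perm-injective x) σ≤N ≤-refl a<σa (proj₂ σa∈))
    where
      σa∈ = perm-inRange x∈ a∈
      L = y-leastReaching x∈ once σa∈
      b = y x (perm x a)

      σ≤N : ∀ {c} → a < c → c ≤ suc n → perm x c ≤ suc n
      σ≤N a<c c≤N = proj₂ (perm-inRange x∈ (≤-trans (s≤s z≤n) a<c , c≤N))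

      σa<σb : perm x a < perm x b
      σa<σb = ≤∧≢⇒< (reaches L) (λ σa≡σb → <-irrefl (perm-injective x (sym σa≡σb)) b<a)

      closed : ∀ {c} → a < c → c ≤ suc n → a < perm x c
      closed {c} a<c c≤N with perm x c ≤? a
      ... | no σc≰a = ≰⇒> σc≰a
      ... | yes σc≤a = contradiction
        ( inverted⇒crossed x b<a σa<σb
        , inverted⇒crossed x a<c (≤-<-trans σc≤a a<σa)
        , inverted⇒crossed x (<-trans b<a a<c) (≤-<-trans σc≤a (<-trans a<σa σa<σb)))
        (¬triangle b a c (positive L) b<a a<c c≤N)

  y-between : ∀ {x a j} → All Letter x → CrossAtMostOnce x → InRange j → y x j ≡ a →
              a ≤ j × j ≤ perm x a
  y-between x∈ once j∈ refl = below L , reaches L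
    where L = y-leastReaching x∈ once j∈

  y-rightmost : ∀ {x} → All Letter x → IsWeb n x →
                ∀ {a} → InRange a → RightmostOf (perm x) a (rightmost (y x) a (suc n))
  y-rightmost {x} x∈ web {a} a∈ with a <? perm x a
  ... | yes a<σa = subst (RightmostOf (perm x) a) (sym found) (moved a<σa)
    where
      σa∈ = perm-inRange x∈ a∈
      found : rightmost (y x) a (suc n) ≡ just (perm x a)
      found = rightmost-last (suc n) (proj₁ σa∈) (proj₂ σa∈) (y-image x∈ web a∈ a<σa)
        λ σa<j j≤N yj≡a →
          <⇒≱ σa<j (proj₂ (y-between x∈ (proj₁ web) (≤-trans (s≤s z≤n) σa<j , j≤N) yj≡a))
  ... | no ¬a<σa with rightmost (y x) a (suc n) in found
  ...   | nothing = absent ¬a<σa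
  ...   | just b = subst (λ b → RightmostOf (perm x) a (just b)) (sym b≡a) (stays ¬a<σa)
    where
      b≡a : b ≡ a
      b≡a with yb≡a , 1≤b , b≤N ← rightmost-sound (suc n) found
             with a≤b , b≤σa ← y-between x∈ (proj₁ web) (1≤b , b≤N) yb≡a
             = ≤-antisym (≤-trans b≤σa (≮⇒≥ ¬a<σa)) a≤b

positions-inRange : ∀ n → All (InRange n) (positions n)
positions-inRange n = applyUpTo⁺₁ suc (suc n) (λ i<1+n → s≤s z≤n , i<1+n)

lemma6p2 : (n : ℕ) (x : List ℕ) → All (λ i → (1 ≤ i) × (i ≤ n)) x →
           IsWeb n x → φ n x ≡ rightSeqCouple n (perm x)
lemma6p2 n x x∈ web = cong unzip (phiPairs-rightmostOf n (y x) (perm x) (positions n)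
  (All.map (y-rightmost n x∈ web) (positions-inRange n)))
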